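{- The generating function $\sum_P x^{\mathrm{col}(P)}$, summed over Stanley polyominoes $P$ with $\mathrm{edgint}(P)=0$, equals \[ \frac{x(1-2x)}{x^{2}-3x+1}. \] Moreover, for $n\geq 2$, the coefficient of $x^n$ in this series is $F_{2n-3}$, where $(F_n)$ is the Fibonacci sequence with $F_0=0$, $F_1=1$, $F_n=F_{n-1}+F_{n-2}$.
   Context: Cells are unit squares $[i,i+1]\times[j,j+1]$ with $i,j\in\mathbb{Z}$. A Stanley polyomino (up to translation) is a set of cells forming $k\geq 1$ rows $0,\dots,k-1$ (bottom to top), row $j$ consisting of the cells with $s_j\le i\le e_j$ ($s_j\le e_j$ integers), such that $s_{j-1}<s_j\le e_{j-1}<e_j$ for $1\le j\le k-1$. $\mathrm{col}(P)=e_{k-1}-s_0+1$ is the number of columns. An interior point of $P$ is a lattice point belonging to exactly four cells of $P$; $\mathrm{edgint}(P)$ is the number of horizontal unit lattice edges both of whose endpoints are interior points of $P$. -}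

module Defs where

open import Data.Nat using (ℕ; zero; suc; _<_)
open import Data.Integer as ℤ using (ℤ; +_; _≤_; _+_; _-_; _*_; -_)
open import Data.Product using (_×_; _,_; ∃; proj₁; proj₂; Σ)
open import Data.List using (List; []; _∷_; length)
open import Data.List.Membership.Propositional using (_∈_)
open import Data.List.Relation.Unary.Unique.Propositional using (Unique)
open import Data.Empty using (⊥)
open import Data.Unit using (⊤)
open import Relation.Binary.PropositionalEquality using (_≡_)
open import Relation.Nullary using (¬_)
open import Function.Bundles using (_⇔_)

-- A row j is the pair (s_j , e_j): it consists of the cells with s_j ≤ i ≤ e_j.
Row : Set
Row = ℤ × ℤ

-- Row data of a polyomino, bottom row first.
Rows : Set
Rows = List Row

ChainFrom : Row → Rows → Set
ChainFrom r [] = ⊤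
ChainFrom (s , e) ((s' , e') ∷ rs) =
  (s ℤ.< s') × (s' ≤ e) × (e ℤ.< e') × (s' ≤ e') × ChainFrom (s' , e') rs

-- A Stanley polyomino, normalised modulo translation: k ≥ 1 rows placed at
-- heights 0..k-1, with s_0 = 0 (each translation class has exactly one such
-- representative).
IsStanley : Rows → Set
IsStanley [] = ⊥
IsStanley ((s , e) ∷ rs) = (s ≡ + 0) × (s ≤ e) × ChainFrom (s , e) rs

-- Cell [i,i+1]×[j,j+1] belongs to the polyomino with row data rs
-- (row r of the list sits at height r).
CellIn : Rows → ℤ → ℤ → Set
CellIn [] i j = ⊥
CellIn ((s , e) ∷ rs) i j =
  (j ≡ + 0 × s ≤ i × i ≤ e) Data.Sum.⊎ CellIn rs i (j - + 1)
  where import Data.Sum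

-- Lattice point (a,b) is interior: it belongs to exactly four cells of P,
-- i.e. all four cells having (a,b) as a corner are in P.
Interior : Rows → ℤ → ℤ → Set
Interior P a b =
  CellIn P (a - + 1) (b - + 1) × CellIn P a (b - + 1) ×
  CellIn P (a - + 1) b × CellIn P a b

-- edgint(P) = 0: there is no horizontal unit edge [(a,b),(a+1,b)] both of
-- whose endpoints are interior points of P.
EdgintZero : Rows → Set
EdgintZero P = ¬ (Σ ℤ λ a → Σ ℤ λ b → Interior P a b × Interior P (a + + 1) b)

lastE : Row → Rows → ℤ
lastE (s , e) [] = e
lastE _ (r ∷ rs) = lastE r rs

col : Rows → ℤ
col [] = + 0
col ((s , e) ∷ rs) = lastE (s , e) rs - s + + 1

HasCard : (Rows → Set) → ℕ → Set
HasCard Q m = Σ (List Rows) λ L → Unique L × (∀ x → (x ∈ L) ⇔ Q x) × (length L ≡ m)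

Counted : ℕ → Rows → Set
Counted n P = IsStanley P × EdgintZero P × (col P ≡ + n)

-- Coefficients of a power series shifted by x: (x·C)_n.
shift : (ℕ → ℤ) → ℕ → ℤ
shift c zero = + 0
shift c (suc n) = c n

-- Coefficient of x^n in (x² - 3x + 1)·C(x).
denTimes : (ℕ → ℤ) → ℕ → ℤ
denTimes c n = shift (shift c) n - + 3 * shift c n + c n

-- Coefficient of x^n in x(1 - 2x) = x - 2x².
numer : ℕ → ℤ
numer 1 = + 1
numer 2 = - (+ 2)
numer _ = + 0

fib : ℕ → ℕ
fib 0 = 0
fib 1 = 1
fib (suc (suc n)) = fib (suc n) Data.Nat.+ fib n
  where import Data.Nat

{-# OPTIONS --safe #-}
-- Consecutive rows (s , e) and (s' , e') of a Stanley polyomino share the columns s' .. e, and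
-- the interior points on the line between them are those strictly inside that overlap; so
-- edgint(P) = 0 exactly when consecutive rows share at most two columns (TightChainFrom).
-- Such a polyomino is built column by column: each new column either extends the top row, or
-- closes it and opens a row sharing one or two columns with it, which keeps the row starts
-- increasing only if the top row has at least two, resp. three, cells.  The number of ways to
-- add m more columns therefore depends only on whether the top row has one, two or at least
-- three cells; in the last two cases it satisfies the Fibonacci recursion and equals F(2m+1),
-- resp. F(2m+2).  This gives F(2n-3) polyominoes with n ≥ 2 columns, and F(k) + F(k+4) = 3F(k+2)
-- is the recurrence encoded by the denominator x² - 3x + 1.

module Submission where

open import Level using (Level)
open import Function using (_∘_)
open import Function.Bundles using (_⇔_; mk⇔; module Equivalence)
open import Function.Definitions using (Injective)
open import Data.Empty using (⊥; ⊥-elim)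
open import Data.Unit using (⊤; tt)
open import Data.Product using (Σ; ∃-syntax; _×_; _,_; proj₂)
open import Data.Sum as Sum using (_⊎_; inj₁; inj₂)
open import Data.List using (List; []; _∷_; [_]; _++_; map; length)
open import Data.List.Membership.Propositional using (_∈_)
open import Data.List.Membership.Propositional.Properties
  using (∈-++⁺ˡ; ∈-++⁺ʳ; ∈-++⁻; ∈-map⁺; ∈-map⁻)
open import Data.List.Relation.Unary.Any using (here)
open import Data.List.Relation.Unary.All using ([])
open import Data.List.Relation.Unary.AllPairs using ([]; _∷_)
open import Data.List.Relation.Unary.Unique.Propositional using (Unique)
import Data.List.Relation.Unary.Unique.Propositional.Properties as Unique
open import Relation.Nullary using (¬_)
open import Relation.Unary using (Pred; _∪_; _∩_; _⊆_; ∅; Empty; ｛_｝)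
open import Relation.Binary.PropositionalEquality
  using (_≡_; refl; sym; trans; cong; subst; subst₂)

open import Defs

open Equivalence using (to; from)

private
  variable
    a p q : Level
    A B : Set a

Enumerates : List A → Pred A p → Set _
Enumerates L P = Unique L × (∀ x → x ∈ L ⇔ P x)

enumerates-[] : {P : Pred A p} → Empty P → Enumerates [] P
enumerates-[] ∉P = [] , λ x → mk⇔ (λ ()) (⊥-elim ∘ ∉P x)

enumerates-[-] : (x : A) → Enumerates [ x ] ｛ x ｝
enumerates-[-] x =
  [] ∷ [] , λ y → mk⇔ (λ { (here refl) → refl }) (λ { refl → here refl })

enumerates-∪ : {L M : List A} {P : Pred A p} {Q : Pred A q} →
               Enumerates L P → Enumerates M Q → P ∩ Q ⊆ ∅ → Enumerates (L ++ M) (P ∪ Q)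
enumerates-∪ {L = L} (uniqueL , enumL) (uniqueM , enumM) P∩Q⊆∅ =
  Unique.++⁺ uniqueL uniqueM (λ (x∈L , x∈M) → P∩Q⊆∅ (to (enumL _) x∈L , to (enumM _) x∈M)) ,
  λ x → mk⇔ (Sum.map (to (enumL x)) (to (enumM x)) ∘ ∈-++⁻ L)
            (Sum.[ ∈-++⁺ˡ ∘ from (enumL x) , ∈-++⁺ʳ L ∘ from (enumM x) ])

enumerates-map : {f : A → B} {L : List A} {P : Pred A p} → Injective _≡_ _≡_ f →
                 Enumerates L P → Enumerates (map f L) (λ y → ∃[ x ] P x × y ≡ f x)
enumerates-map {f = f} f-inj (uniqueL , enumL) =
  Unique.map⁺ f-inj uniqueL ,
  λ y → mk⇔ (λ y∈fL → let x , x∈L , y≡fx = ∈-map⁻ f y∈fL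
                       in x , to (enumL x) x∈L , y≡fx)
            (λ { (x , Px , refl) → ∈-map⁺ f (from (enumL x) Px) })

enumerates-⇔ : {L : List A} {P : Pred A p} {Q : Pred A q} →
               (∀ x → P x ⇔ Q x) → Enumerates L P → Enumerates L Q
enumerates-⇔ P⇔Q (uniqueL , enumL) =
  uniqueL , λ x → mk⇔ (to (P⇔Q x) ∘ to (enumL x)) (from (enumL x) ∘ from (P⇔Q x))

module Geometry where

  open import Data.Nat using (ℕ; zero; suc)
  open import Data.Integer using (ℤ; +_; -[1+_]; _+_; _-_; _≤_; _<_)
  open import Data.Integer.Properties
    using (≤-refl; ≤-trans; ≤-reflexive; <⇒≤; <-irrefl; <-≤-trans; ≮⇒≥; +-comm; +-monoʳ-≤;
           i-j≤i; i≤j+i; i<j⇒suc[i]≤j; suc[i]≤j⇒i<j)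
  open import Data.Integer.Tactic.RingSolver using (solve-∀)

  TightChainFrom : Row → Rows → Set
  TightChainFrom r [] = ⊤
  TightChainFrom (s , e) ((s' , e') ∷ rs) =
    s < s' × s' ≤ e × e < e' × e ≤ + 1 + s' × TightChainFrom (s' , e') rs

  tightChain⇒chain : ∀ r rs → TightChainFrom r rs → ChainFrom r rs
  tightChain⇒chain r [] _ = tt
  tightChain⇒chain (s , e) ((s' , e') ∷ rs) (s<s' , s'≤e , e<e' , _ , tight) =
    s<s' , s'≤e , e<e' , ≤-trans s'≤e (<⇒≤ e<e') , tightChain⇒chain (s' , e') rs tight

  CellAt : Rows → ℤ → ℕ → Set
  CellAt [] i n = ⊥
  CellAt ((s , e) ∷ rs) i zero = s ≤ i × i ≤ e
  CellAt (r ∷ rs) i (suc n) = CellAt rs i n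

  cellIn-negative : ∀ P i k → ¬ CellIn P i -[1+ k ]
  cellIn-negative (r ∷ rs) i k (inj₂ cell) = cellIn-negative rs i _ cell

  cellIn⇒cellAt : ∀ P i n → CellIn P i (+ n) → CellAt P i n
  cellIn⇒cellAt (r ∷ rs) i zero (inj₁ (_ , cell)) = cell
  cellIn⇒cellAt (r ∷ rs) i zero (inj₂ cell) = ⊥-elim (cellIn-negative rs i 0 cell)
  cellIn⇒cellAt (r ∷ rs) i (suc n) (inj₂ cell) = cellIn⇒cellAt rs i n cell

  cellAt⇒cellIn : ∀ P i n → CellAt P i n → CellIn P i (+ n)
  cellAt⇒cellIn (r ∷ rs) i zero cell = inj₁ (refl , cell)
  cellAt⇒cellIn (r ∷ rs) i (suc n) cell = inj₂ (cellAt⇒cellIn rs i n cell)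

  -- the lattice point (a , n + 1), between rows n and n + 1
  InteriorAt : Rows → ℤ → ℕ → Set
  InteriorAt P a n =
    CellAt P (a - + 1) n × CellAt P a n × CellAt P (a - + 1) (suc n) × CellAt P a (suc n)

  NoInteriorEdge : Rows → Set
  NoInteriorEdge P = ∀ a n → InteriorAt P a n → ¬ InteriorAt P (a + + 1) n

  edgintZero⇒noInteriorEdge : ∀ P → EdgintZero P → NoInteriorEdge P
  edgintZero⇒noInteriorEdge P edgintZero a n I J =
    edgintZero (a , + suc n , interior I , interior J)
    where
      interior : ∀ {a} → InteriorAt P a n → Interior P a (+ suc n)
      interior (c₁ , c₂ , c₃ , c₄) =
        cellAt⇒cellIn P _ n c₁ , cellAt⇒cellIn P _ n c₂ ,
        cellAt⇒cellIn P _ (suc n) c₃ , cellAt⇒cellIn P _ (suc n) c₄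

  tightChain-adjacent-cells : ∀ r rs {i j} n → TightChainFrom r rs →
                     CellAt (r ∷ rs) i n → CellAt (r ∷ rs) j (suc n) → i ≤ + 1 + j
  tightChain-adjacent-cells (s , e) ((s' , e') ∷ rs) zero
                            (_ , _ , _ , e≤1+s' , _) (_ , i≤e) (s'≤j , _) =
    ≤-trans i≤e (≤-trans e≤1+s' (+-monoʳ-≤ (+ 1) s'≤j))
  tightChain-adjacent-cells r (r' ∷ rs) (suc n) (_ , _ , _ , _ , tight) =
    tightChain-adjacent-cells r' rs n tight

  tightChain⇒edgintZero : ∀ r rs → TightChainFrom r rs → EdgintZero (r ∷ rs)
  tightChain⇒edgintZero r rs tight (a , -[1+ k ] , (_ , _ , _ , cell) , _) =
    cellIn-negative (r ∷ rs) a k cell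
  tightChain⇒edgintZero r rs tight (a , + zero , (cell , _) , _) =
    cellIn-negative (r ∷ rs) (a - + 1) 0 cell
  tightChain⇒edgintZero r rs tight (a , + suc n , (_ , _ , left , _) , (_ , right , _ , _)) =
    <-irrefl refl (suc[i]≤j⇒i<j (subst₂ _≤_ (+-comm a (+ 1)) (1+[a-1]≡a a)
      (tightChain-adjacent-cells r rs n tight
        (cellIn⇒cellAt (r ∷ rs) _ n right) (cellIn⇒cellAt (r ∷ rs) _ (suc n) left))))
    where
      1+[a-1]≡a : ∀ a → + 1 + (a - + 1) ≡ a
      1+[a-1]≡a = solve-∀

  overlap-interiorAt : ∀ s e s' e' rs a → s < s' → e < e' → s' ≤ a - + 1 → a ≤ e →
                       InteriorAt ((s , e) ∷ (s' , e') ∷ rs) a 0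
  overlap-interiorAt s e s' e' rs a s<s' e<e' s'≤a-1 a≤e =
    (s≤ s'≤a-1 , ≤-trans a-1≤a a≤e) , (s≤ s'≤a , a≤e) ,
    (s'≤a-1 , ≤-trans a-1≤a a≤e') , (s'≤a , a≤e')
    where
      a-1≤a = i-j≤i a (+ 1)
      s'≤a = ≤-trans s'≤a-1 a-1≤a
      a≤e' = ≤-trans a≤e (<⇒≤ e<e')
      s≤ : ∀ {x} → s' ≤ x → s ≤ x
      s≤ = ≤-trans (<⇒≤ s<s')

  chain∧noInteriorEdge⇒tightChain : ∀ r rs → ChainFrom r rs → NoInteriorEdge (r ∷ rs) →
                                    TightChainFrom r rs
  chain∧noInteriorEdge⇒tightChain r [] _ _ = tt
  chain∧noInteriorEdge⇒tightChain (s , e) ((s' , e') ∷ rs)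
                                  (s<s' , s'≤e , e<e' , _ , chain) noEdge =
    s<s' , s'≤e , e<e' , ≮⇒≥ overlap≤2 ,
    chain∧noInteriorEdge⇒tightChain (s' , e') rs chain (λ a n → noEdge a (suc n))
    where
      interiorAt : ∀ a → s' ≤ a - + 1 → a ≤ e → InteriorAt ((s , e) ∷ (s' , e') ∷ rs) a 0
      interiorAt a = overlap-interiorAt s e s' e' rs a s<s' e<e'
      s'≡[1+s']-1 : ∀ s' → s' ≡ (+ 1 + s') - + 1
      s'≡[1+s']-1 = solve-∀
      [2+s']-1≡1+s' : ∀ s' → ((+ 1 + s') + + 1) - + 1 ≡ + 1 + s'
      [2+s']-1≡1+s' = solve-∀
      overlap≤2 : ¬ (+ 1 + s' < e)
      overlap≤2 1+s'<e = noEdge (+ 1 + s') 0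
        (interiorAt (+ 1 + s') (≤-reflexive (s'≡[1+s']-1 s')) (<⇒≤ 1+s'<e))
        (interiorAt (+ 1 + s' + + 1)
          (≤-trans (i≤j+i s' (+ 1)) (≤-reflexive (sym ([2+s']-1≡1+s' s'))))
          (subst (_≤ e) (+-comm (+ 1) (+ 1 + s')) (i<j⇒suc[i]≤j 1+s'<e)))

  lastE-≥ : ∀ r rs → TightChainFrom r rs → proj₂ r ≤ lastE r rs
  lastE-≥ r [] _ = ≤-refl
  lastE-≥ (s , e) ((s' , e') ∷ rs) (_ , _ , e<e' , _ , tight) =
    ≤-trans (<⇒≤ e<e') (lastE-≥ (s' , e') rs tight)

  lastE-> : ∀ r r' rs → TightChainFrom r (r' ∷ rs) → proj₂ r < lastE r (r' ∷ rs)
  lastE-> (s , e) (s' , e') rs (_ , _ , e<e' , _ , tight) =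
    <-≤-trans e<e' (lastE-≥ (s' , e') rs tight)

  col≡⇒lastE≡ : ∀ e rs n → col ((+ 0 , e) ∷ rs) ≡ + n → lastE (+ 0 , e) rs ≡ + n - + 1
  col≡⇒lastE≡ e rs n col≡n =
    trans (x≡[x-0+1]-1 (lastE (+ 0 , e) rs)) (cong (_- + 1) col≡n)
    where
      x≡[x-0+1]-1 : ∀ x → x ≡ (x - + 0 + + 1) - + 1
      x≡[x-0+1]-1 = solve-∀

  lastE≡⇒col≡ : ∀ e rs m → lastE (+ 0 , e) rs ≡ + m → col ((+ 0 , e) ∷ rs) ≡ + suc m
  lastE≡⇒col≡ e rs m lastE≡m =
    trans (x-0+1≡1+x (lastE (+ 0 , e) rs)) (cong (λ x → + 1 + x) lastE≡m)
    where
      x-0+1≡1+x : ∀ x → x - + 0 + + 1 ≡ + 1 + x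
      x-0+1≡1+x = solve-∀

module Completions where

  open import Data.Nat using (ℕ; zero; suc; _+_; _≤_; _<_; z≤n; s≤s)
  open import Data.Nat.Properties
    using (≤-refl; ≤-antisym; <⇒≤; <⇒≱; <-irrefl; m≤n⇒m<n∨m≡n; n≤1+n; m≤m+n; m≤n+m; 1+n≢n;
           +-suc; +-identityʳ)
  open import Data.Integer as ℤ using (ℤ; +_; +≤+; +<+)
  open import Data.Integer.Properties as ℤ using (+-injective)
  open import Data.List.Properties using (∷-injectiveʳ)
  open Geometry

  Tail : Row → ℤ → Rows → Set
  Tail r t rs = TightChainFrom r rs × lastE r rs ≡ t

  Completes : ℕ → ℕ → ℕ → Rows → Set
  Completes s e t P = ∃[ c ] ∃[ rs ] P ≡ (+ s , + c) ∷ rs × e ≤ c × Tail (+ s , + c) (+ t) rs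

  NextRowStart : ℕ → ℕ → ℕ → Set
  NextRowStart s e b = s < b × b ≤ e × e ≤ suc b

  Continues : ℕ → ℕ → ℕ → Rows → Set
  Continues s e t rs = ∃[ b ] NextRowStart s e b × Completes b (suc e) t rs

  FirstRowEndsAt : ℕ → ℕ → ℕ → Rows → Set
  FirstRowEndsAt s e t P = ∃[ rs ] Continues s e t rs × P ≡ (+ s , + e) ∷ rs

  nextRowStart-cases : ∀ {s e b} → NextRowStart s e b → b ≡ e ⊎ suc b ≡ e
  nextRowStart-cases (_ , b≤e , e≤1+b) with m≤n⇒m<n∨m≡n b≤e
  ... | inj₁ b<e = inj₂ (≤-antisym b<e e≤1+b)
  ... | inj₂ b≡e = inj₁ b≡e

  completes-start-unique : ∀ {b b' e e' t t' P} →
                           Completes b e t P → Completes b' e' t' P → b ≡ b'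
  completes-start-unique (_ , _ , refl , _) (_ , _ , refl , _) = refl

  continues⇔tail : ∀ s e t rs → e < t → Continues s e t rs ⇔ Tail (+ s , + e) (+ t) rs
  continues⇔tail s e t rs e<t = mk⇔
    (λ { (b , (s<b , b≤e , e≤1+b) , c , rs' , refl , e<c , tight , lastE≡t) →
         (+<+ s<b , +≤+ b≤e , +<+ e<c , +≤+ e≤1+b , tight) , lastE≡t })
    (from-tail rs)
    where
      from-tail : ∀ rs → Tail (+ s , + e) (+ t) rs → Continues s e t rs
      from-tail [] (_ , e≡t) = ⊥-elim (<-irrefl (+-injective e≡t) e<t)
      from-tail ((_ , _) ∷ rs') ((+<+ s<b , +≤+ b≤e , +<+ e<c , +≤+ e≤1+b , tight) , lastE≡t) =
        _ , (s<b , b≤e , e≤1+b) , _ , rs' , refl , e<c , tight , lastE≡t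

  single-row⇔completes : ∀ s t P → ｛ (+ s , + t) ∷ [] ｝ P ⇔ Completes s t t P
  single-row⇔completes s t P = mk⇔ (λ { refl → t , [] , refl , ≤-refl , tt , refl }) to-single
    where
      to-single : Completes s t t P → (+ s , + t) ∷ [] ≡ P
      to-single (c , [] , refl , _ , _ , c≡t) rewrite +-injective c≡t = refl
      to-single (c , r ∷ rs , refl , t≤c , tight , lastE≡t) =
        ⊥-elim (ℤ.<⇒≱ (subst (+ c ℤ.<_) lastE≡t (lastE-> _ r rs tight)) (+≤+ t≤c))

  completes-unfold : ∀ s e t P → e < t →
                     (Completes s (suc e) t ∪ FirstRowEndsAt s e t) P ⇔ Completes s e t P
  completes-unfold s e t P e<t = mk⇔
    Sum.[ (λ { (c , rs , refl , e<c , tail) → c , rs , refl , <⇒≤ e<c , tail })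
        , (λ { (rs , continues , refl) →
               e , rs , refl , ≤-refl , to (continues⇔tail s e t rs e<t) continues }) ]
    (λ { (c , rs , refl , e≤c , tail) → split c rs e≤c tail })
    where
      split : ∀ c rs → e ≤ c → Tail (+ s , + c) (+ t) rs →
              (Completes s (suc e) t ∪ FirstRowEndsAt s e t) ((+ s , + c) ∷ rs)
      split c rs e≤c tail with m≤n⇒m<n∨m≡n e≤c
      ... | inj₁ e<c = inj₁ (c , rs , refl , e<c , tail)
      ... | inj₂ refl = inj₂ (rs , from (continues⇔tail s e t rs e<t) tail , refl)

  first-row-end-disjoint : ∀ s e t → Completes s (suc e) t ∩ FirstRowEndsAt s e t ⊆ ∅
  first-row-end-disjoint s e t ((_ , _ , refl , e<e , _) , (_ , _ , refl)) = <-irrefl refl e<e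

  continues-after-two-cells : ∀ s t rs →
                              Completes (suc s) (suc (suc s)) t rs ⇔ Continues s (suc s) t rs
  continues-after-two-cells s t rs =
    mk⇔ (λ completes → suc s , (≤-refl , ≤-refl , n≤1+n _) , completes) from-continues
    where
      from-continues : Continues s (suc s) t rs → Completes (suc s) (suc (suc s)) t rs
      from-continues (b , start@(s<b , _) , completes) with nextRowStart-cases start
      ... | inj₁ refl = completes
      ... | inj₂ refl = ⊥-elim (<-irrefl refl s<b)

  continues-after-long-row : ∀ s k t rs → let e = suc (suc k) + s in
    (Completes e (suc e) t ∪ Completes (suc k + s) (suc e) t) rs ⇔ Continues s e t rs
  continues-after-long-row s k t rs = mk⇔
    Sum.[ (λ completes → _ , (s≤s (m≤n+m s (suc k)) , ≤-refl , n≤1+n _) , completes)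
        , (λ completes → _ , (s≤s (m≤n+m s k) , n≤1+n _ , ≤-refl) , completes) ]
    from-continues
    where
      e = suc (suc k) + s
      from-continues : Continues s e t rs →
                       (Completes e (suc e) t ∪ Completes (suc k + s) (suc e) t) rs
      from-continues (b , start , completes) with nextRowStart-cases start
      ... | inj₁ refl = inj₁ completes
      ... | inj₂ refl = inj₂ completes

  -- The first row starts at column s and reaches column ℓ + s (written this way round so that
  -- the recursive calls agree definitionally); m further columns are still to be added.
  mutual
    completions : ℕ → ℕ → ℕ → List Rows
    completions s ℓ zero    = [ (+ s , + (ℓ + s)) ∷ [] ]
    completions s ℓ (suc m) =
      completions s (suc ℓ) m ++ map ((+ s , + (ℓ + s)) ∷_) (continuations s ℓ m)

    continuations : ℕ → ℕ → ℕ → List Rows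
    continuations s zero          m = []
    continuations s (suc zero)    m = completions (suc s) 1 m
    continuations s (suc (suc k)) m =
      completions (suc (suc k) + s) 1 m ++ completions (suc k + s) 2 m

  mutual
    completions-enumerate : ∀ s ℓ m →
      Enumerates (completions s ℓ m) (Completes s (ℓ + s) (ℓ + s + m))
    completions-enumerate s ℓ zero =
      subst (λ t → Enumerates (completions s ℓ zero) (Completes s (ℓ + s) t))
        (sym (+-identityʳ (ℓ + s)))
        (enumerates-⇔ (single-row⇔completes s (ℓ + s)) (enumerates-[-] _))
    completions-enumerate s ℓ (suc m) =
      subst (λ t → Enumerates (completions s ℓ (suc m)) (Completes s (ℓ + s) t))
        (sym (+-suc (ℓ + s) m))
        (enumerates-⇔ (λ P → completes-unfold s (ℓ + s) _ P (s≤s (m≤m+n (ℓ + s) m)))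
          (enumerates-∪ (completions-enumerate s (suc ℓ) m)
                        (enumerates-map ∷-injectiveʳ (continuations-enumerate s ℓ m))
                        (first-row-end-disjoint s (ℓ + s) _)))

    continuations-enumerate : ∀ s ℓ m →
      Enumerates (continuations s ℓ m) (Continues s (ℓ + s) (suc (ℓ + s) + m))
    continuations-enumerate s zero m =
      enumerates-[] λ { _ (_ , (s<b , b≤s , _) , _) → <⇒≱ s<b b≤s }
    continuations-enumerate s (suc zero) m =
      enumerates-⇔ (continues-after-two-cells s _) (completions-enumerate (suc s) 1 m)
    continuations-enumerate s (suc (suc k)) m =
      enumerates-⇔ (continues-after-long-row s k _)
        (enumerates-∪ (completions-enumerate _ 1 m) (completions-enumerate _ 2 m)
                      (λ (long , short) → 1+n≢n (completes-start-unique long short)))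

  polyominoes : ℕ → List Rows
  polyominoes zero    = []
  polyominoes (suc m) = completions 0 0 m

  counted⇒tail : ∀ n P → Counted n P →
                 ∃[ c ] ∃[ rs ] P ≡ (+ 0 , + c) ∷ rs × Tail (+ 0 , + c) (+ n ℤ.- + 1) rs
  counted⇒tail n [] (() , _)
  counted⇒tail n ((_ , _) ∷ rs) ((refl , +≤+ z≤n , chain) , edgintZero , col≡n) =
    _ , rs , refl ,
    chain∧noInteriorEdge⇒tightChain _ rs chain (edgintZero⇒noInteriorEdge _ edgintZero) ,
    col≡⇒lastE≡ _ rs n col≡n

  completes⇔counted : ∀ m P → Completes 0 0 m P ⇔ Counted (suc m) P
  completes⇔counted m P = mk⇔
    (λ { (c , rs , refl , _ , tight , lastE≡m) →
         (refl , +≤+ z≤n , tightChain⇒chain _ rs tight) ,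
         tightChain⇒edgintZero _ rs tight , lastE≡⇒col≡ _ rs m lastE≡m })
    (λ counted → let c , rs , P≡ , tail = counted⇒tail (suc m) P counted
                 in c , rs , P≡ , z≤n , tail)

  polyominoes-enumerate : ∀ n → Enumerates (polyominoes n) (Counted n)
  polyominoes-enumerate zero = enumerates-[] λ P counted →
    let c , rs , _ , tight , lastE≡-1 = counted⇒tail 0 P counted in
    +≰-1 (subst (+ c ℤ.≤_) lastE≡-1 (lastE-≥ _ rs tight))
    where
      +≰-1 : ∀ {c} → ¬ (+ c ℤ.≤ ℤ.-[1+ 0 ])
      +≰-1 ()
  polyominoes-enumerate (suc m) =
    enumerates-⇔ (completes⇔counted m) (completions-enumerate 0 0 m)

module Counting where

  open import Data.Nat using (ℕ; zero; suc; _+_; _*_; _∸_; _≤_; s≤s)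
  open import Data.Nat.Properties using (+-suc; +-assoc; +-identityʳ)
  import Data.Nat.Tactic.RingSolver as ℕ-Solver
  open import Data.Integer as ℤ using (+_)
  import Data.Integer.Properties as ℤ
  import Data.Integer.Tactic.RingSolver as ℤ-Solver
  open import Data.List.Properties using (length-++; length-map)
  open import Relation.Binary.PropositionalEquality using (cong₂; module ≡-Reasoning)
  open ≡-Reasoning
  open Completions

  length-completions-suc : ∀ s ℓ m → length (completions s ℓ (suc m)) ≡
                           length (completions s (suc ℓ) m) + length (continuations s ℓ m)
  length-completions-suc s ℓ m =
    trans (length-++ (completions s (suc ℓ) m))
          (cong (λ n → length (completions s (suc ℓ) m) + n) (length-map _ (continuations s ℓ m)))

  double-suc : ∀ m → suc m + suc m ≡ suc (suc (m + m))
  double-suc m = cong suc (+-suc m m)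

  mutual
    length-completions-1 : ∀ s m → length (completions s 1 m) ≡ fib (suc (m + m))
    length-completions-1 s zero = refl
    length-completions-1 s (suc m) = begin
      length (completions s 1 (suc m))
        ≡⟨ length-completions-suc s 1 m ⟩
      length (completions s 2 m) + length (completions (suc s) 1 m)
        ≡⟨ cong₂ _+_ (length-completions-2+ s 0 m) (length-completions-1 (suc s) m) ⟩
      fib (suc (suc (suc (m + m))))
        ≡⟨ cong (fib ∘ suc) (double-suc m) ⟨
      fib (suc (suc m + suc m)) ∎

    length-completions-2+ : ∀ s k m →
                            length (completions s (suc (suc k)) m) ≡ fib (suc (suc (m + m)))
    length-completions-2+ s k zero = refl
    length-completions-2+ s k (suc m) = begin
      length (completions s (2 + k) (suc m))
        ≡⟨ length-completions-suc s (2 + k) m ⟩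
      length (completions s (3 + k) m) + length (completions e 1 m ++ completions e' 2 m)
        ≡⟨ cong (λ n → length (completions s (3 + k) m) + n) (length-++ (completions e 1 m)) ⟩
      length (completions s (3 + k) m) +
        (length (completions e 1 m) + length (completions e' 2 m))
        ≡⟨ cong₂ _+_ (length-completions-2+ s (suc k) m)
                     (cong₂ _+_ (length-completions-1 e m) (length-completions-2+ e' 0 m)) ⟩
      F₂ + (F₁ + F₂)
        ≡⟨ +-assoc F₂ F₁ F₂ ⟨
      fib (suc (suc (suc (suc (m + m)))))
        ≡⟨ cong (fib ∘ suc ∘ suc) (double-suc m) ⟨
      fib (suc (suc (suc m + suc m))) ∎
      where
        e = suc (suc k) + s
        e' = suc k + s
        F₁ = fib (suc (m + m))
        F₂ = fib (suc (suc (m + m)))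

  count : ℕ → ℕ
  count n = length (polyominoes n)

  count[2+m]≡fib[1+m+m] : ∀ m → count (2 + m) ≡ fib (suc (m + m))
  count[2+m]≡fib[1+m+m] m = begin
    count (2 + m)                    ≡⟨ length-completions-suc 0 0 m ⟩
    length (completions 0 1 m) + 0   ≡⟨ +-identityʳ _ ⟩
    length (completions 0 1 m)       ≡⟨ length-completions-1 0 m ⟩
    fib (suc (m + m))                ∎

  fib[k]+fib[4+k]≡3*fib[2+k] : ∀ k → fib k + fib (4 + k) ≡ 3 * fib (2 + k)
  fib[k]+fib[4+k]≡3*fib[2+k] k = identity (fib (suc k)) (fib k)
    where
      -- fib (4 + k) unfolds to ((x + y) + x) + (x + y) for x = fib (1 + k), y = fib k
      identity : ∀ x y → y + (((x + y) + x) + (x + y)) ≡ 3 * (x + y)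
      identity = ℕ-Solver.solve-∀

  count-recurrence : ∀ m → count (1 + m) + count (3 + m) ≡ 3 * count (2 + m)
  -- count 1 = 1 would be F(-1), outside the range of count[2+m]≡fib[1+m+m]
  count-recurrence zero = refl
  count-recurrence (suc k) = begin
    count (2 + k) + count (4 + k)
      ≡⟨ cong₂ _+_ (count[2+m]≡fib[1+m+m] k) (count[2+m]≡fib[1+m+m] (2 + k)) ⟩
    fib (suc (k + k)) + fib (suc (suc (suc k) + suc (suc k)))
      ≡⟨ cong (λ i → fib (suc (k + k)) + fib (suc i)) quadruple-suc ⟩
    fib (suc (k + k)) + fib (4 + suc (k + k))
      ≡⟨ fib[k]+fib[4+k]≡3*fib[2+k] (suc (k + k)) ⟩
    3 * fib (2 + suc (k + k))
      ≡⟨ cong (λ i → 3 * fib (suc i)) (double-suc k) ⟨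
    3 * fib (suc (suc k + suc k))
      ≡⟨ cong (3 *_) (count[2+m]≡fib[1+m+m] (suc k)) ⟨
    3 * count (3 + k) ∎
    where
      quadruple-suc : suc (suc k) + suc (suc k) ≡ 4 + (k + k)
      quadruple-suc = trans (double-suc (suc k)) (cong (suc ∘ suc) (double-suc k))

  count≡fib : ∀ n → 2 ≤ n → count n ≡ fib (2 * n ∸ 3)
  count≡fib (suc zero) (s≤s ())
  count≡fib (suc (suc m)) _ = trans (count[2+m]≡fib[1+m+m] m) (cong (fib ∘ (_∸ 3)) (index m))
    where
      index : ∀ m → 3 + suc (m + m) ≡ 2 * (2 + m)
      index = ℕ-Solver.solve-∀

  recurrence⇒denTimes≡0 : ∀ x y z → x + z ≡ 3 * y → + x ℤ.- + 3 ℤ.* + y ℤ.+ + z ≡ + 0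
  recurrence⇒denTimes≡0 x y z x+z≡3y = begin
    + x ℤ.- + 3 ℤ.* + y ℤ.+ + z    ≡⟨ rearrange (+ x) (+ y) (+ z) ⟩
    + (x + z) ℤ.- + 3 ℤ.* + y      ≡⟨ cong (λ w → + w ℤ.- + 3 ℤ.* + y) x+z≡3y ⟩
    + (3 * y) ℤ.- + 3 ℤ.* + y      ≡⟨ cong (ℤ._- + 3 ℤ.* + y) (ℤ.pos-* 3 y) ⟩
    + 3 ℤ.* + y ℤ.- + 3 ℤ.* + y    ≡⟨ ℤ.+-inverseʳ (+ 3 ℤ.* + y) ⟩
    + 0                            ∎
    where
      rearrange : ∀ x y z → x ℤ.- + 3 ℤ.* y ℤ.+ z ≡ (x ℤ.+ z) ℤ.- + 3 ℤ.* y
      rearrange = ℤ-Solver.solve-∀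

  denTimes-count≡numer : ∀ n → denTimes (λ k → + count k) n ≡ numer n
  denTimes-count≡numer 0 = refl
  denTimes-count≡numer 1 = refl
  denTimes-count≡numer 2 = refl
  denTimes-count≡numer (suc (suc (suc m))) =
    recurrence⇒denTimes≡0 (count (1 + m)) (count (2 + m)) (count (3 + m)) (count-recurrence m)

open import Data.Nat using (ℕ; _≤_; _*_; _∸_)
open import Data.Integer using (+_)
open Counting using (count; count≡fib; denTimes-count≡numer)

corollary2p4 : Σ (ℕ → ℕ) λ c →
    ((n : ℕ) → HasCard (Counted n) (c n)) ×
    ((n : ℕ) → denTimes (λ k → + (c k)) n ≡ numer n) ×
    ((n : ℕ) → 2 ≤ n → c n ≡ fib (2 * n ∸ 3))
corollary2p4 = count , hasCard , denTimes-count≡numer , count≡fib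
  where
    hasCard : ∀ n → HasCard (Counted n) (count n)
    hasCard n = let unique , enumerates = Completions.polyominoes-enumerate n
                in Completions.polyominoes n , unique , enumerates , refl
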